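{- Let $(S,\leq)$ be an ordered set and $S'$ an isolated suborder with bottleneck of $(S,\leq)$. Let $C'$ be a closure system of $(S/{\equiv_{S'}},\leq_{\equiv_{S'}})$ with $S'\notin C'$. Then $C=\bigcup_{A\in C'}A$ is a closure system of $(S,\leq)$.
   Context: A subset $C$ of an ordered set $(P,\preceq)$ is a closure system if for every $p\in P$ the set $\{y\in C\mid p\preceq y\}$ has a least element. A subset $S'\subseteq S$ is an isolated suborder if (1) $S'$ has a greatest element $\top_{S'}$ and a least element $\bot_{S'}$; (2) for all $x\notin S'$ and $y'\in S'$, $y'\leq x$ implies $\top_{S'}\leq x$; (3) for all $x\notin S'$ and $y'\in S'$, $x\leq y'$ implies $x\leq\bot_{S'}$. An element $b$ is a bottleneck of $x$ if $b>x$, the interval $[x,b]$ is a chain, and for all $y\in S$, $y>x$ implies $y\in[x,b]$ or $y>b$. An isolated suborder with bottleneck is an isolated suborder $S'$ such that $\top_{S'}$ has a bottleneck. The equivalence $\equiv_{S'}$ on $S$ is defined by $x\equiv_{S'}y$ iff ($x\in S'\Leftrightarrow y\in S'$); its classes are $S'$ and the singletons $\{x\}$, $x\notin S'$. The quotient relation $\leq_{\equiv_{S'}}$ on $S/{\equiv_{S'}}$ is defined by $[x]\leq_{\equiv_{S'}}[y]$ iff there exist $x'\in[x]$, $y'\in[y]$ with $x'\leq y'$ (this is an order). -}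

module Defs where

open import Data.Product using (Σ; ∃; _×_; _,_)
open import Data.Sum using (_⊎_)
open import Relation.Nullary using (¬_)
open import Relation.Binary.PropositionalEquality using (_≡_)
open import Relation.Binary.Structures using (IsPartialOrder)

ClosureSystem : {A : Set} → (A → A → Set) → (A → Set) → Set
ClosureSystem {A} _≼_ C =
  (p : A) → Σ A (λ y → (C y × p ≼ y) × ((z : A) → C z → p ≼ z → y ≼ z))

module Order {S : Set} (_≤_ : S → S → Set) where

  _<_ : S → S → Set
  x < y = x ≤ y × ¬ (x ≡ y)

  Interval : S → S → S → Set
  Interval x b y = x ≤ y × y ≤ b

  IsChain : (S → Set) → Set
  IsChain P = (u v : S) → P u → P v → u ≤ v ⊎ v ≤ u

  IsBottleneck : S → S → Set
  IsBottleneck x b =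
    x < b × IsChain (Interval x b) ×
    ((y : S) → x < y → Interval x b y ⊎ b < y)

  record IsIsolatedSuborder (S' : S → Set) : Set where
    field
      top       : S
      bot       : S
      top∈      : S' top
      bot∈      : S' bot
      greatest  : (y : S) → S' y → y ≤ top
      least     : (y : S) → S' y → bot ≤ y
      isoUp     : (x y' : S) → ¬ S' x → S' y' → y' ≤ x → top ≤ x
      isoDown   : (x y' : S) → ¬ S' x → S' y' → x ≤ y' → x ≤ bot

  record IsIsolatedSuborderWithBottleneck (S' : S → Set) : Set where
    field
      isolated   : IsIsolatedSuborder S'
      bottleneck : S
      isBottleneck : IsBottleneck (IsIsolatedSuborder.top isolated) bottleneck

  -- the equivalence ≡_{S'}: classes are S' and the singletons {x}, x ∉ S'
  _~[_]_ : S → (S → Set) → S → Set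
  x ~[ S' ] y = x ≡ y ⊎ (S' x × S' y)

  -- quotient order on S/≡_{S'}, on representatives
  _≤q[_]_ : S → (S → Set) → S → Set
  x ≤q[ S' ] y = Σ S (λ x' → Σ S (λ y' → x' ~[ S' ] x × y' ~[ S' ] y × x' ≤ y'))

  -- a set of equivalence classes, given by a predicate on representatives
  -- closed under ≡_{S'}
  IsClassSet : (S → Set) → (S → Set) → Set
  IsClassSet S' C' = (x y : S) → x ~[ S' ] y → C' x → C' y

  -- ⋃_{A ∈ C'} A : x lies in some class [a] with [a] ∈ C'
  UnionOf : (S → Set) → (S → Set) → S → Set
  UnionOf S' C' x = Σ S (λ a → C' a × x ~[ S' ] a)

{-# OPTIONS --safe #-}
module Submission where

-- Since S' ∉ C', every class in C' is a singleton {y} with y ∉ S'. Above such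
-- a y the quotient order agrees with the order of S: a related pair whose left
-- end lies in S' is, by isolation, already dominated by the top of S', hence
-- the whole of S' lies below y. So the least class of C' above [p] is the least
-- element of the union above p.

open import Defs
open import Data.Empty using (⊥-elim)
open import Data.Product using (_,_)
open import Data.Sum using (inj₁; inj₂)
open import Relation.Binary.Definitions using (Transitive)
open import Relation.Binary.PropositionalEquality using (_≡_; refl)
open import Relation.Binary.Structures using (IsPartialOrder)
open import Relation.Nullary using (¬_)

module _ {S : Set} (_≤_ : S → S → Set) (S' : S → Set) where
  open Order _≤_

  ~-sym : ∀ {x y} → x ~[ S' ] y → y ~[ S' ] x
  ~-sym (inj₁ refl)       = inj₁ refl
  ~-sym (inj₂ (sx , sy)) = inj₂ (sy , sx)

  ~-outside⇒≡ : ∀ {x y} → ¬ S' y → x ~[ S' ] y → x ≡ y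
  ~-outside⇒≡ y∉ (inj₁ x≡y)      = x≡y
  ~-outside⇒≡ y∉ (inj₂ (_ , sy)) = ⊥-elim (y∉ sy)

  ≤⇒≤q : ∀ {x y} → x ≤ y → x ≤q[ S' ] y
  ≤⇒≤q {x} {y} x≤y = x , y , inj₁ refl , inj₁ refl , x≤y

  ≤q-outside⇒≤ : Transitive _≤_ → IsIsolatedSuborder S' →
                 ∀ {x y} → ¬ S' y → x ≤q[ S' ] y → x ≤ y
  ≤q-outside⇒≤ trans iso {x} {y} y∉ (x' , y' , x'~x , y'~y , x'≤y')
    with ~-outside⇒≡ y∉ y'~y
  ... | refl with x'~x
  ...   | inj₁ refl       = x'≤y'
  ...   | inj₂ (sx' , sx) =
    trans (greatest x sx) (isoUp y x' y∉ sx' x'≤y')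
    where open IsIsolatedSuborder iso

  UnionOf⇒member : ∀ {C'} → IsClassSet S' C' → ∀ {x} → UnionOf S' C' x → C' x
  UnionOf⇒member closed {x} (a , ca , x~a) = closed a x (~-sym x~a) ca

  member⇒UnionOf : ∀ {C' x} → C' x → UnionOf S' C' x
  member⇒UnionOf {x = x} cx = x , cx , inj₁ refl

lemma5p8 : {S : Set} (_≤_ : S → S → Set) → IsPartialOrder _≡_ _≤_ →
    (S' : S → Set) → Order.IsIsolatedSuborderWithBottleneck _≤_ S' →
    (C' : S → Set) → Order.IsClassSet _≤_ S' C' →
    ClosureSystem (λ x y → Order._≤q[_]_ _≤_ x S' y) C' →
    ((s : S) → S' s → ¬ C' s) →
    ClosureSystem _≤_ (Order.UnionOf _≤_ S' C')
lemma5p8 _≤_ po S' iso C' closed closure S'∉C' p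
  with closure p
... | y , (cy , p≤qy) , leastq =
  y , (member⇒UnionOf _≤_ S' cy , ≤q⇒≤ cy p≤qy) , least
  where
  open Order _≤_
  open IsIsolatedSuborderWithBottleneck iso using (isolated)
  ≤q⇒≤ : ∀ {x z} → C' z → x ≤q[ S' ] z → x ≤ z
  ≤q⇒≤ {z = z} cz =
    ≤q-outside⇒≤ _≤_ S' (IsPartialOrder.trans po) isolated (λ sz → S'∉C' z sz cz)
  least : ∀ z → UnionOf S' C' z → p ≤ z → y ≤ z
  least z z∈ p≤z = ≤q⇒≤ cz (leastq z cz (≤⇒≤q _≤_ S' p≤z))
    where
    cz : C' z
    cz = UnionOf⇒member _≤_ S' closed z∈
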